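{- For all integers $p,q$ with $2\leq p\leq q$, there exists a graph $G$ with $\mathrm{fix}(G)=p$ and $\mathrm{fxd}(G)=q$.
   Context: Graphs are finite and simple. $\mathrm{Aut}(G)$ is the automorphism group of $G$; for $S\subseteq V(G)$, $\mathrm{stab}(S)=\{g\in \mathrm{Aut}(G): g(v)=v \text{ for all } v\in S\}$; $S$ is a fixing set if $\mathrm{stab}(S)$ is trivial. $\mathrm{fix}(G)$ is the minimum cardinality of a fixing set of $G$; $\mathrm{fxd}(G)$ is the minimum $k$ such that every $k$-element subset of $V(G)$ is a fixing set of $G$. -}

module Defs where

open import Data.Nat using (ℕ; _≤_; _<_)
open import Data.Bool using (Bool; false)
open import Data.Fin using (Fin)
open import Data.Fin.Subset using (Subset; _∈_; ∣_∣)
open import Data.Fin.Permutation using (Permutation′; _⟨$⟩ʳ_)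
open import Data.Product using (Σ; _×_)
open import Relation.Binary.PropositionalEquality using (_≡_)
open import Relation.Nullary using (¬_)

record Graph : Set where
  field
    n      : ℕ
    adj    : Fin n → Fin n → Bool
    adj-sym    : ∀ u v → adj u v ≡ adj v u
    adj-irrefl : ∀ v → adj v v ≡ false

open Graph public

IsAut : (G : Graph) → Permutation′ (n G) → Set
IsAut G σ = ∀ u v → adj G (σ ⟨$⟩ʳ u) (σ ⟨$⟩ʳ v) ≡ adj G u v

IsFixingSet : (G : Graph) → Subset (n G) → Set
IsFixingSet G S = (σ : Permutation′ (n G)) → IsAut G σ →
  (∀ v → v ∈ S → σ ⟨$⟩ʳ v ≡ v) → ∀ v → σ ⟨$⟩ʳ v ≡ v

FixNumber : Graph → ℕ → Set
FixNumber G p =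
  Σ (Subset (n G)) (λ S → IsFixingSet G S × ∣ S ∣ ≡ p)
  × (∀ S → IsFixingSet G S → p ≤ ∣ S ∣)

AllKSubsetsFixing : Graph → ℕ → Set
AllKSubsetsFixing G k = ∀ (S : Subset (n G)) → ∣ S ∣ ≡ k → IsFixingSet G S

FixedNumber : Graph → ℕ → Set
FixedNumber G q = AllKSubsetsFixing G q × (∀ k → k < q → ¬ AllKSubsetsFixing G k)

-- Take p + 1 pairwise non-adjacent vertices at level 0 and stack m further vertices on top,
-- the one at level ℓ being adjacent to everything below it exactly when ℓ is odd. Level-0
-- vertices are twins, so a fixing set misses at most one of them and fix(G) ≥ p. Conversely
-- p of them suffice, because the stacked vertices are rigid: by downward induction, the
-- highest moved vertex would be sent strictly below itself, yet it is adjacent to all or to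
-- none of its down-set, while no lower vertex is. Finally a graph with two twins has
-- fxd(G) = |V(G)| − 1, here p + m.
module Submission where

open import Defs
open import Data.Nat using (ℕ; _≤_)
open import Data.Product using (Σ; _×_)

open import Data.Bool using (Bool; false; not; if_then_else_)
open import Data.Bool.Properties using (not-¬)
open import Data.Empty using (⊥-elim)
open import Data.Fin as Fin using (Fin; zero; suc; toℕ; inject₁)
open import Data.Fin.Induction using (>-wellFounded)
open import Data.Fin.Permutation
  using (Permutation′; _⟨$⟩ʳ_; _⟨$⟩ˡ_; inverseˡ; inverseʳ; flip; transpose)
open import Data.Fin.Properties using (_≟_; any?; toℕ-inject₁; ≤∧≢⇒<; <⇒≢)
open import Data.Fin.Subset using (Subset; _∈_; _∉_; _⊆_; _⊂_; _∪_; _-_; ⁅_⁆; ∣_∣; ⊤; ⊥; inside; outside)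
open import Data.Fin.Subset.Properties
  using (_∈?_; ∉⊥; ∈⊤; x∈⁅x⁆; x∈p∪q⁺; ∪-identityʳ; ∣⊥∣≡0; ∣⊤∣≡n; p⊆q⇒∣p∣≤∣q∣; p⊂q⇒∣p∣<∣q∣;
         x∈p⇒∣p-x∣<∣p∣; x∈p∧x≢y⇒x∈p-y)
open import Data.Nat using (zero; suc; _+_; _∸_; _⊔_; _<_; z≤n; s≤s; _<?_; _≤?_)
open import Data.Nat.Properties
  using (≤-refl; ≤-trans; <-trans; ≤-pred; n≤1+n; 1+n≰n; ≰⇒>; <⇒≱; ≮⇒≥; m≤m+n; m≤n⇒m∸n≡0;
         0∸n≡0; ∸-monoˡ-≤; +-∸-assoc; ⊔-comm; m≤n⇒m⊔n≡n; m≤n⇒∃[o]m+o≡n; module ≤-Reasoning)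
open import Data.Product using (_,_; ∃-syntax)
open import Data.Sum using (inj₁; inj₂)
open import Data.Vec.Base using (_∷_; here; there)
open import Function using (_∘_)
open import Function.Bundles using (Injection)
open import Function.Properties.Inverse using (↔⇒↣)
open import Induction.WellFounded using (Acc; acc)
open import Relation.Binary.PropositionalEquality
open import Relation.Nullary using (¬_; Dec; yes; no; does; contradiction)
open import Relation.Nullary.Decidable using (dec-true; dec-false; decidable-stable; _×-dec_; ¬?)

private
  variable
    N : ℕ

prefix : ∀ a → a ≤ N → Subset N
prefix zero    _         = ⊥
prefix (suc a) (s≤s a≤n) = inside ∷ prefix a a≤n

∣prefix∣ : ∀ a (a≤n : a ≤ N) → ∣ prefix a a≤n ∣ ≡ a
∣prefix∣ {N} zero _         = ∣⊥∣≡0 N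
∣prefix∣ (suc a) (s≤s a≤n) = cong suc (∣prefix∣ a a≤n)

<⇒∈prefix : ∀ {a} (a≤n : a ≤ N) {x : Fin N} → toℕ x < a → x ∈ prefix a a≤n
<⇒∈prefix (s≤s _)   {zero}  _         = here
<⇒∈prefix (s≤s a≤n) {suc x} (s≤s x<a) = there (<⇒∈prefix a≤n x<a)

∈prefix⇒< : ∀ {a} (a≤n : a ≤ N) {x : Fin N} → x ∈ prefix a a≤n → toℕ x < a
∈prefix⇒< {a = zero}  _         x∈⊥         = ⊥-elim (∉⊥ x∈⊥)
∈prefix⇒< {a = suc a} (s≤s _)   here        = s≤s z≤n
∈prefix⇒< {a = suc a} (s≤s a≤n) (there x∈p) = s≤s (∈prefix⇒< a≤n x∈p)

∣p∪⁅x⁆∣≤1+∣p∣ : ∀ (p : Subset N) x → ∣ p ∪ ⁅ x ⁆ ∣ ≤ suc ∣ p ∣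
∣p∪⁅x⁆∣≤1+∣p∣ (outside ∷ p) zero    rewrite ∪-identityʳ p = ≤-refl
∣p∪⁅x⁆∣≤1+∣p∣ (inside  ∷ p) zero    rewrite ∪-identityʳ p = n≤1+n _
∣p∪⁅x⁆∣≤1+∣p∣ (outside ∷ p) (suc x) = ∣p∪⁅x⁆∣≤1+∣p∣ p x
∣p∪⁅x⁆∣≤1+∣p∣ (inside  ∷ p) (suc x) = s≤s (∣p∪⁅x⁆∣≤1+∣p∣ p x)

x∉p∧y∉p⇒2+∣p∣≤n : ∀ {p : Subset N} {x y} → x ≢ y → x ∉ p → y ∉ p → 2 + ∣ p ∣ ≤ N
x∉p∧y∉p⇒2+∣p∣≤n {N} {p} {x} {y} x≢y x∉p y∉p = begin
  2 + ∣ p ∣         ≤⟨ s≤s (p⊂q⇒∣p∣<∣q∣ p⊂⊤-x) ⟩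
  suc ∣ ⊤ {N} - x ∣ ≤⟨ x∈p⇒∣p-x∣<∣p∣ (∈⊤ {x = x}) ⟩
  ∣ ⊤ {N} ∣         ≡⟨ ∣⊤∣≡n N ⟩
  N                 ∎
  where
  open ≤-Reasoning
  p⊂⊤-x : p ⊂ ⊤ - x
  p⊂⊤-x = (λ {z} z∈p → x∈p∧x≢y⇒x∈p-y ∈⊤ λ { refl → x∉p z∈p })
        , y , x∈p∧x≢y⇒x∈p-y ∈⊤ (x≢y ∘ sym) , y∉p

⟨$⟩ʳ-injective : ∀ (π : Permutation′ N) {x y} → π ⟨$⟩ʳ x ≡ π ⟨$⟩ʳ y → x ≡ y
⟨$⟩ʳ-injective π = Injection.injective (↔⇒↣ π)

transpose-i↦j : ∀ (i j : Fin N) → transpose i j ⟨$⟩ʳ i ≡ j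
transpose-i↦j i j rewrite dec-true (i ≟ i) refl = refl

transpose-j↦i : ∀ {i j : Fin N} → i ≢ j → transpose i j ⟨$⟩ʳ j ≡ i
transpose-j↦i {i = i} {j} i≢j rewrite dec-false (j ≟ i) (i≢j ∘ sym) | dec-true (j ≟ j) refl = refl

transpose-fixes : ∀ {i j k : Fin N} → k ≢ i → k ≢ j → transpose i j ⟨$⟩ʳ k ≡ k
transpose-fixes {i = i} {j} {k} k≢i k≢j rewrite dec-false (k ≟ i) k≢i | dec-false (k ≟ j) k≢j = refl

transpose-invariant : ∀ {A : Set} (f : Fin N → A) {i j} → f i ≡ f j →
                      ∀ k → f (transpose i j ⟨$⟩ʳ k) ≡ f k
transpose-invariant f {i} {j} fi≡fj k = by-cases (k ≟ i) (k ≟ j)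
  where
  by-cases : Dec (k ≡ i) → Dec (k ≡ j) → f (transpose i j ⟨$⟩ʳ k) ≡ f k
  by-cases (yes refl) _          = trans (cong f (transpose-i↦j k j)) (sym fi≡fj)
  by-cases (no k≢i)   (yes refl) = trans (cong f (transpose-j↦i (k≢i ∘ sym))) fi≡fj
  by-cases (no k≢i)   (no k≢j)   = cong f (transpose-fixes k≢i k≢j)

fixes-all-but-one : ∀ (π : Permutation′ N) x → (∀ v → v ≢ x → π ⟨$⟩ʳ v ≡ v) → ∀ v → π ⟨$⟩ʳ v ≡ v
fixes-all-but-one π x fixed v with v ≟ x
... | no v≢x = fixed v v≢x
... | yes refl with π ⟨$⟩ʳ v ≟ v
...   | yes πv≡v = πv≡v
...   | no πv≢v = ⊥-elim (πv≢v (⟨$⟩ʳ-injective π (fixed (π ⟨$⟩ʳ v) πv≢v)))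

FixesAbove : Permutation′ N → Fin N → Set
FixesAbove π v = ∀ w → v Fin.< w → π ⟨$⟩ʳ w ≡ w

fixesAbove-flip : ∀ (π : Permutation′ N) {v} → FixesAbove π v → FixesAbove (flip π) v
fixesAbove-flip π fixed w v<w = trans (cong (π ⟨$⟩ˡ_) (sym (fixed w v<w))) (inverseˡ π)

fixesAbove⇒≤-closed : ∀ (π : Permutation′ N) {v} → FixesAbove π v →
                      ∀ {u} → u Fin.≤ v → π ⟨$⟩ʳ u Fin.≤ v
fixesAbove⇒≤-closed π {v} fixed {u} u≤v with toℕ (π ⟨$⟩ʳ u) ≤? toℕ v
... | yes πu≤v = πu≤v
... | no  πu≰v = contradiction u≤v (<⇒≱ (subst (v Fin.<_) u≡πu (≰⇒> πu≰v)))
  where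
  u≡πu : π ⟨$⟩ʳ u ≡ u
  u≡πu = ⟨$⟩ʳ-injective π (fixed (π ⟨$⟩ʳ u) (≰⇒> πu≰v))

module _ (G : Graph) where

  swap-escapes : ∀ {S i j} → IsAut G (transpose i j) → i ≢ j → i ∉ S → j ∉ S → ¬ IsFixingSet G S
  swap-escapes {S} {i} {j} aut i≢j i∉S j∉S fixing =
    i≢j (trans (sym (fixing (transpose i j) aut fixes-S i)) (transpose-i↦j i j))
    where
    fixes-S : ∀ x → x ∈ S → transpose i j ⟨$⟩ʳ x ≡ x
    fixes-S x x∈S = transpose-fixes (λ { refl → i∉S x∈S }) (λ { refl → j∉S x∈S })

  twins-bound : ∀ (T S : Subset (n G)) → (∀ {i j} → i ∈ T → j ∈ T → IsAut G (transpose i j)) →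
                IsFixingSet G S → ∣ T ∣ ≤ suc ∣ S ∣
  twins-bound T S twins fixing with any? (λ x → (x ∈? T) ×-dec ¬? (x ∈? S))
  ... | no T⊆S = ≤-trans (p⊆q⇒∣p∣≤∣q∣ T⊆S′) (n≤1+n ∣ S ∣)
    where
    T⊆S′ : T ⊆ S
    T⊆S′ {y} y∈T = decidable-stable (y ∈? S) (λ y∉S → T⊆S (y , y∈T , y∉S))
  ... | yes (x , x∈T , x∉S) = ≤-trans (p⊆q⇒∣p∣≤∣q∣ T⊆S∪x) (∣p∪⁅x⁆∣≤1+∣p∣ S x)
    where
    T⊆S∪x : T ⊆ S ∪ ⁅ x ⁆
    T⊆S∪x {y} y∈T with y ≟ x
    ... | yes refl = x∈p∪q⁺ (inj₂ (x∈⁅x⁆ x))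
    ... | no  y≢x  = x∈p∪q⁺ (inj₁ (decidable-stable (y ∈? S) λ y∉S →
                       swap-escapes (twins y∈T x∈T) y≢x y∉S x∉S fixing))

  co-singletons-fixing : ∀ {k} → suc k ≡ n G → AllKSubsetsFixing G k
  co-singletons-fixing {k} 1+k≡n S ∣S∣≡k σ _ fixes-S v with v ∈? S
  ... | yes v∈S = fixes-S v v∈S
  ... | no  v∉S = fixes-all-but-one σ v fixes-others v
    where
    fixes-others : ∀ w → w ≢ v → σ ⟨$⟩ʳ w ≡ w
    fixes-others w w≢v = fixes-S w (decidable-stable (w ∈? S) λ w∉S →
      1+n≰n (subst₂ (λ s t → 2 + s ≤ t) ∣S∣≡k (sym 1+k≡n) (x∉p∧y∉p⇒2+∣p∣≤n w≢v w∉S v∉S)))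

odd : ℕ → Bool
odd zero    = false
odd (suc ℓ) = not (odd ℓ)

-- Vertices 0 … p form level 0; vertex p + ℓ is the one at level ℓ.
module LevelGraph (p₀ m : ℕ) where

  p : ℕ
  p = suc p₀

  V : Set
  V = Fin (suc (p + m))

  p≤p+m : p ≤ p + m
  p≤p+m = m≤m+n p m

  level : V → ℕ
  level v = toℕ v ∸ p

  edge : V → V → Bool
  edge u v = if does (u ≟ v) then false else odd (level u ⊔ level v)

  edge-≢ : ∀ {u v} → u ≢ v → edge u v ≡ odd (level u ⊔ level v)
  edge-≢ {u} {v} u≢v rewrite dec-false (u ≟ v) u≢v = refl

  edge-irrefl : ∀ v → edge v v ≡ false
  edge-irrefl v rewrite dec-true (v ≟ v) refl = refl

  edge-sym : ∀ u v → edge u v ≡ edge v u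
  edge-sym u v with u ≟ v
  ... | yes refl = sym (edge-irrefl u)
  ... | no u≢v rewrite dec-false (v ≟ u) (u≢v ∘ sym) | ⊔-comm (level u) (level v) = refl

  G : Graph
  G = record { n = suc (p + m) ; adj = edge ; adj-sym = edge-sym ; adj-irrefl = edge-irrefl }

  edge-below : ∀ {u v} → u Fin.< v → edge u v ≡ odd (level v)
  edge-below {u} {v} u<v =
    trans (edge-≢ (<⇒≢ u<v)) (cong odd (m≤n⇒m⊔n≡n (∸-monoˡ-≤ p (≤-trans (n≤1+n _) u<v))))

  level-invariant⇒aut : ∀ π → (∀ v → level (π ⟨$⟩ʳ v) ≡ level v) → IsAut G π
  level-invariant⇒aut π invariant u v with u ≟ v
  ... | yes refl = edge-irrefl (π ⟨$⟩ʳ u)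
  ... | no u≢v = trans (edge-≢ (u≢v ∘ ⟨$⟩ʳ-injective π))
                       (cong₂ (λ a b → odd (a ⊔ b)) (invariant u) (invariant v))

  transpose-aut : ∀ {i j} → level i ≡ level j → IsAut G (transpose i j)
  transpose-aut same = level-invariant⇒aut (transpose _ _) (transpose-invariant level same)

  level-suc : ∀ {w : Fin (p + m)} → p ≤ toℕ w → level (suc w) ≡ suc (level (inject₁ w))
  level-suc {w} p≤w = trans (+-∸-assoc 1 p≤w) (cong (λ t → suc (t ∸ p)) (sym (toℕ-inject₁ w)))

  parity-flips : ∀ {w : Fin (p + m)} → p ≤ toℕ w → ∀ {b} →
                 b ≡ odd (level (inject₁ w)) → b ≢ odd (level (suc w))
  parity-flips p≤w b≡ rewrite level-suc p≤w = not-¬ b≡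

  -- The vertex just below v, at level ℓ, sees y at level ℓ (zero does if y is that vertex),
  -- whereas v sees everything below it at level ℓ + 1.
  irregular-below : ∀ {v y : V} → p < toℕ v → y Fin.< v →
                    ∃[ z ] z Fin.< v × z ≢ y × edge y z ≢ odd (level v)
  irregular-below {suc w} {y} (s≤s p≤w) y<v with y ≟ inject₁ w
  ... | yes refl = zero , s≤s z≤n , <⇒≢ 0<w₁ ,
                   parity-flips p≤w (trans (edge-sym (inject₁ w) zero) (edge-below 0<w₁))
    where
    0<w₁ : 0 < toℕ (inject₁ w)
    0<w₁ = subst (0 <_) (sym (toℕ-inject₁ w)) (≤-trans (s≤s z≤n) p≤w)
  ... | no y≢w₁ = inject₁ w , w₁<v , y≢w₁ ∘ sym , parity-flips p≤w (edge-below y<w₁)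
    where
    w₁<v : inject₁ w Fin.< suc w
    w₁<v = s≤s (subst (_≤ toℕ w) (sym (toℕ-inject₁ w)) ≤-refl)
    y<w₁ : y Fin.< inject₁ w
    y<w₁ = ≤∧≢⇒< (subst (toℕ y ≤_) (sym (toℕ-inject₁ w)) (≤-pred y<v)) y≢w₁

  module _ (σ : Permutation′ (suc (p + m))) (σ-aut : IsAut G σ) where

    fixes-next : ∀ {v} → p < toℕ v → FixesAbove σ v → σ ⟨$⟩ʳ v ≡ v
    fixes-next {v} p<v fixed with σ ⟨$⟩ʳ v ≟ v
    ... | yes σv≡v = σv≡v
    ... | no  σv≢v with irregular-below p<v (≤∧≢⇒< (fixesAbove⇒≤-closed σ fixed ≤-refl) σv≢v)
    ...   | z , z<v , z≢σv , irregular = ⊥-elim (irregular regular)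
      where
      z′ : V
      z′ = σ ⟨$⟩ˡ z
      z′<v : z′ Fin.< v
      z′<v = ≤∧≢⇒< (fixesAbove⇒≤-closed (flip σ) (fixesAbove-flip σ fixed) (≤-trans (n≤1+n _) z<v))
                   (λ { refl → z≢σv (sym (inverseʳ σ)) })
      regular : edge (σ ⟨$⟩ʳ v) z ≡ odd (level v)
      regular = begin
        edge (σ ⟨$⟩ʳ v) z          ≡⟨ cong (edge (σ ⟨$⟩ʳ v)) (sym (inverseʳ σ)) ⟩
        edge (σ ⟨$⟩ʳ v) (σ ⟨$⟩ʳ z′) ≡⟨ σ-aut v z′ ⟩
        edge v z′                  ≡⟨ edge-sym v z′ ⟩
        edge z′ v                  ≡⟨ edge-below z′<v ⟩
        odd (level v)              ∎
        where open ≡-Reasoning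

    fixes-upper : ∀ v → p < toℕ v → σ ⟨$⟩ʳ v ≡ v
    fixes-upper v = go v (>-wellFounded v)
      where
      go : ∀ v → Acc Fin._>_ v → p < toℕ v → σ ⟨$⟩ʳ v ≡ v
      go v (acc below) p<v = fixes-next p<v λ w v<w → go w (below v<w) (<-trans p<v v<w)

  S₀ : Subset (suc (p + m))
  S₀ = outside ∷ prefix p p≤p+m

  S₀-fixing : IsFixingSet G S₀
  S₀-fixing σ σ-aut fixes-S₀ = fixes-all-but-one σ zero fixes-nonzero
    where
    fixes-nonzero : ∀ v → v ≢ zero → σ ⟨$⟩ʳ v ≡ v
    fixes-nonzero zero    0≢0 = ⊥-elim (0≢0 refl)
    fixes-nonzero (suc v) _ with toℕ v <? p
    ... | yes v<p = fixes-S₀ (suc v) (there (<⇒∈prefix p≤p+m v<p))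
    ... | no  v≮p = fixes-upper σ σ-aut (suc v) (s≤s (≮⇒≥ v≮p))

  level₀ : Subset (suc (p + m))
  level₀ = prefix (suc p) (s≤s p≤p+m)

  level₀-twins : ∀ {i j} → i ∈ level₀ → j ∈ level₀ → IsAut G (transpose i j)
  level₀-twins i∈ j∈ = transpose-aut (trans (at-level₀ i∈) (sym (at-level₀ j∈)))
    where
    at-level₀ : ∀ {v} → v ∈ level₀ → level v ≡ 0
    at-level₀ v∈ = m≤n⇒m∸n≡0 (≤-pred (∈prefix⇒< (s≤s p≤p+m) v∈))

  fix-number : FixNumber G p
  fix-number = (S₀ , S₀-fixing , ∣prefix∣ p p≤p+m) , λ S fixing →
    ≤-pred (subst (_≤ suc ∣ S ∣) (∣prefix∣ (suc p) (s≤s p≤p+m))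
                  (twins-bound G level₀ S level₀-twins fixing))

  fixed-number : FixedNumber G (p + m)
  fixed-number = co-singletons-fixing G refl , not-all-fixing
    where
    not-all-fixing : ∀ k → k < p + m → ¬ AllKSubsetsFixing G k
    not-all-fixing k (s≤s k≤p₀+m) all =
      swap-escapes G {i = zero} {j = suc zero} (transpose-aut (sym (0∸n≡0 p₀)))
                   (λ ()) (λ ()) (λ { (there ()) })
        (all (outside ∷ outside ∷ prefix k k≤p₀+m) (∣prefix∣ k k≤p₀+m))

theorem6 : ∀ (p q : ℕ) → 2 ≤ p → p ≤ q →
    Σ Graph (λ G → FixNumber G p × FixedNumber G q)
theorem6 (suc p₀) q (s≤s _) p≤q with m≤n⇒∃[o]m+o≡n p≤q
... | m , refl = G , fix-number , fixed-number
  where open LevelGraph p₀ m
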